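{- For every modal tree $\mathtt{T}$, every $\mathbf{k}\in\mathrm{Pos}(\mathtt{T})$ and every modal tree $\mathtt{S}$: if $\mathtt{T}|_\mathbf{k}\hookrightarrow^{*}\mathtt{S}$, then $\mathtt{T}\hookrightarrow^{*}\mathtt{T}[\mathtt{S}]_\mathbf{k}$.
   Context: Modal trees: recursively, pairs $\langle\Delta;\Gamma\rangle$ with $\Delta$ a finite list of propositional variables and $\Gamma$ a finite list of pairs $(\alpha,\mathtt{S})$, $\alpha<\omega$, $\mathtt{S}$ a modal tree. Positions: $\mathrm{Pos}(\langle\Delta;\varnothing\rangle)=\{\epsilon\}$; $\mathrm{Pos}(\langle\Delta;[(\alpha_1,\mathtt{S}_1),\dots,(\alpha_n,\mathtt{S}_n)]\rangle)=\{\epsilon\}\cup\bigcup_{i=1}^n\{i\mathbf{k}\mid\mathbf{k}\in\mathrm{Pos}(\mathtt{S}_i)\}$. Subtree: $\mathtt{T}|_\epsilon=\mathtt{T}$, $\mathtt{T}|_{i\mathbf{r}}=\mathtt{S}_i|_{\mathbf{r}}$. Replacement: $\mathtt{T}[\mathtt{S}]_\epsilon=\mathtt{S}$, $\mathtt{T}[\mathtt{S}]_{i\mathbf{r}}$ is $\mathtt{T}$ with its $i$-th child $\mathtt{S}_i$ replaced by $\mathtt{S}_i[\mathtt{S}]_{\mathbf{r}}$ (same edge label). List operations, for $0<i,j\le|\Gamma|$: $\#_i\Gamma$ is the $i$-th element; $\Gamma^{ -i}$ deletes it; $\Gamma^{+i}=(\#_i\Gamma)\frown\Gamma$; $\Gamma[x]_i$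 replaces the $i$-th element by $x$; $\Gamma^{i\leftrightarrow j}$ swaps the $i$-th and $j$-th elements; similarly $\Delta^{ -n},\Delta^{+n}$. $\mathsf{TRC}$ rules: for a modal tree $\mathtt{T}$, $\mathbf{k}\in\mathrm{Pos}(\mathtt{T})$ with $\mathtt{T}|_\mathbf{k}=\langle\Delta;\Gamma\rangle$: ($\rho^+$) $\mathtt{T}\hookrightarrow\mathtt{T}[\langle\Delta^{+i};\Gamma\rangle]_\mathbf{k}$, $0<i\le|\Delta|$; ($\rho^-$) $\mathtt{T}\hookrightarrow\mathtt{T}[\langle\Delta^{ -i};\Gamma\rangle]_\mathbf{k}$; ($\sigma$) $\mathtt{T}\hookrightarrow\mathtt{T}[\langle\Delta;\Gamma^{i\leftrightarrow j}\rangle]_\mathbf{k}$, $i\neq j$; ($\pi^+$) $\mathtt{T}\hookrightarrow\mathtt{T}[\langle\Delta;\Gamma^{+i}\rangle]_\mathbf{k}$; ($\pi^-$) $\mathtt{T}\hookrightarrow\mathtt{T}[\langle\Delta;\Gamma^{ -i}\rangle]_\mathbf{k}$; ($\mathfrak{4}$) if $\#_i\Gamma=(\beta,\langle\tilde\Delta;\tilde\Gamma\rangle)$ and $\#_j\tilde\Gamma=(\beta,\mathtt{S})$, then $\mathtt{T}\hookrightarrow\mathtt{T}[\langle\Delta;\Gamma[(\beta,\mathtt{S})]_i\rangle]_\mathbf{k}$; ($\lambda$) if $\#_i\Gamma=(\alpha,\mathtt{S})$ and $\alpha>\beta$, then $\mathtt{T}\hookrightarrow\mathtt{T}[\langle\Delta;\Gamma[(\beta,\mathtt{S})]_i\rangle]_\mathbf{k}$;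 ($\mathsf{J}$) if $i\ne j$, $\#_i\Gamma=(\alpha,\langle\tilde\Delta;\tilde\Gamma\rangle)$, $\#_j\Gamma=(\beta,\mathtt{S})$, $\alpha>\beta$, then $\mathtt{T}\hookrightarrow\mathtt{T}[\langle\Delta;(\Gamma[(\alpha,\langle\tilde\Delta;\tilde\Gamma\frown(\beta,\mathtt{S})\rangle)]_i)^{ -j}\rangle]_\mathbf{k}$. $\hookrightarrow$ is the union of these relations, $\hookrightarrow^*$ its reflexive-transitive closure. -}

module Defs where

open import Data.Nat using (ℕ; zero; suc; _<_; _>_; _≤_)
open import Data.List using (List; []; _∷_; length; _∷ʳ_)
open import Data.Product using (_×_; _,_)
open import Data.Maybe using (Maybe; just; nothing)
open import Relation.Binary.PropositionalEquality using (_≡_; _≢_)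
open import Relation.Binary.Construct.Closure.ReflexiveTransitive using (Star)

PropVar : Set
PropVar = ℕ

data ModalTree : Set where
  ⟨_⨾_⟩ : List PropVar → List (ℕ × ModalTree) → ModalTree

-- List operations, with 1-based indices as in the paper.
-- The rules only use them at indices 0 < i ≤ |l|, which is guaranteed by
-- requiring  nth i l ≡ just x  (this holds iff 0 < i ≤ |l|).

nth : {A : Set} → ℕ → List A → Maybe A
nth _             []       = nothing
nth zero          (_ ∷ _)  = nothing
nth (suc zero)    (x ∷ _)  = just x
nth (suc (suc n)) (_ ∷ xs) = nth (suc n) xs

del : {A : Set} → ℕ → List A → List A
del _             []       = []
del zero          (x ∷ xs) = x ∷ xs
del (suc zero)    (_ ∷ xs) = xs
del (suc (suc n)) (x ∷ xs) = x ∷ del (suc n) xs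

upd : {A : Set} → ℕ → A → List A → List A
upd _             _ []       = []
upd zero          _ (x ∷ xs) = x ∷ xs
upd (suc zero)    y (_ ∷ xs) = y ∷ xs
upd (suc (suc n)) y (x ∷ xs) = x ∷ upd (suc n) y xs

-- l^{+i} = (#_i l) ⁀ l   (given #_i l = x)
-- l^{i↔j} : swap the i-th and j-th elements (given #_i l = x, #_j l = y)
swp : {A : Set} → ℕ → ℕ → A → A → List A → List A
swp i j x y l = upd j x (upd i y l)

-- Positions: finite words over positive naturals (1-based child indices).

Position : Set
Position = List ℕ

data _∈Pos_ : Position → ModalTree → Set where
  ε    : ∀ {Δ Γ} → [] ∈Pos ⟨ Δ ⨾ Γ ⟩
  _∷ₚ_ : ∀ {Δ Γ} {i α S} {r : Position} →
         nth i Γ ≡ just (α , S) → r ∈Pos S → (i ∷ r) ∈Pos ⟨ Δ ⨾ Γ ⟩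

-- Subtree T|_k (T|_{ir} = S_i|_r; out-of-range positions return T itself,
-- irrelevant since only used at k ∈ Pos(T)).
mutual
  _∣_ : ModalTree → Position → ModalTree
  T ∣ [] = T
  ⟨ Δ ⨾ Γ ⟩ ∣ (i ∷ r) = subL Γ i r ⟨ Δ ⨾ Γ ⟩

  subL : List (ℕ × ModalTree) → ℕ → Position → ModalTree → ModalTree
  subL []             _             _ d = d
  subL (_ ∷ _)        zero          _ d = d
  subL ((_ , S) ∷ _)  (suc zero)    r d = S ∣ r
  subL (_ ∷ xs)       (suc (suc n)) r d = subL xs (suc n) r d

-- Replacement T[S]_k (edge labels kept; identity at out-of-range positions).
mutual
  _[_]at_ : ModalTree → ModalTree → Position → ModalTree
  T [ S ]at [] = S
  ⟨ Δ ⨾ Γ ⟩ [ S ]at (i ∷ r) = ⟨ Δ ⨾ repL Γ i S r ⟩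

  repL : List (ℕ × ModalTree) → ℕ → ModalTree → Position → List (ℕ × ModalTree)
  repL []              _             _ _ = []
  repL (x ∷ xs)        zero          _ _ = x ∷ xs
  repL ((α , U) ∷ xs)  (suc zero)    S r = (α , U [ S ]at r) ∷ xs
  repL (x ∷ xs)        (suc (suc n)) S r = x ∷ repL xs (suc n) S r

data RootStep : ModalTree → ModalTree → Set where
  ρ⁺ : ∀ {Δ Γ i p} → nth i Δ ≡ just p →
       RootStep ⟨ Δ ⨾ Γ ⟩ ⟨ p ∷ Δ ⨾ Γ ⟩
  ρ⁻ : ∀ {Δ Γ i p} → nth i Δ ≡ just p →
       RootStep ⟨ Δ ⨾ Γ ⟩ ⟨ del i Δ ⨾ Γ ⟩
  σ  : ∀ {Δ Γ i j x y} → nth i Γ ≡ just x → nth j Γ ≡ just y → i ≢ j →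
       RootStep ⟨ Δ ⨾ Γ ⟩ ⟨ Δ ⨾ swp i j x y Γ ⟩
  π⁺ : ∀ {Δ Γ i x} → nth i Γ ≡ just x →
       RootStep ⟨ Δ ⨾ Γ ⟩ ⟨ Δ ⨾ x ∷ Γ ⟩
  π⁻ : ∀ {Δ Γ i x} → nth i Γ ≡ just x →
       RootStep ⟨ Δ ⨾ Γ ⟩ ⟨ Δ ⨾ del i Γ ⟩
  four : ∀ {Δ Γ i j β Δ̃ Γ̃ S} →
       nth i Γ ≡ just (β , ⟨ Δ̃ ⨾ Γ̃ ⟩) → nth j Γ̃ ≡ just (β , S) →
       RootStep ⟨ Δ ⨾ Γ ⟩ ⟨ Δ ⨾ upd i (β , S) Γ ⟩
  lam : ∀ {Δ Γ i α β S} →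
       nth i Γ ≡ just (α , S) → α > β →
       RootStep ⟨ Δ ⨾ Γ ⟩ ⟨ Δ ⨾ upd i (β , S) Γ ⟩
  J  : ∀ {Δ Γ i j α β Δ̃ Γ̃ S} → i ≢ j →
       nth i Γ ≡ just (α , ⟨ Δ̃ ⨾ Γ̃ ⟩) → nth j Γ ≡ just (β , S) → α > β →
       RootStep ⟨ Δ ⨾ Γ ⟩
         ⟨ Δ ⨾ del j (upd i (α , ⟨ Δ̃ ⨾ Γ̃ ∷ʳ (β , S) ⟩) Γ) ⟩

data _↪_ : ModalTree → ModalTree → Set where
  step : ∀ {T U} (k : Position) → k ∈Pos T → RootStep (T ∣ k) U →
         T ↪ (T [ U ]at k)

_↪*_ : ModalTree → ModalTree → Set
_↪*_ = Star _↪_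

{-# OPTIONS --safe #-}
module Submission where

-- A rule applied at position r of the subtree U is a rule applied at position
-- k ++ r of T[U]_k, and the result is T[U[W]_r]_k.  Hence U ↦ T[U]_k maps
-- ↪-steps to ↪-steps and so ↪*-chains to ↪*-chains; start the image of the
-- chain at T = T[T|_k]_k.

open import Defs
open import Data.Nat using (ℕ; zero; suc)
open import Data.List using (List; []; _∷_; _++_)
open import Data.Product using (_×_; _,_)
open import Data.Maybe using (just)
open import Relation.Binary.PropositionalEquality using (_≡_; refl; cong; subst; sym; module ≡-Reasoning)
open ≡-Reasoning
open import Relation.Binary.Construct.Closure.ReflexiveTransitive using (gmap)

private
  variable
    A : Set
    T U V W S : ModalTree
    k r : Position
    α : ℕ
    x y : A

nth-upd : ∀ (l : List A) i → nth i l ≡ just x → nth i (upd i y l) ≡ just y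
nth-upd (_ ∷ _) (suc zero)    _ = refl
nth-upd (_ ∷ l) (suc (suc i)) e = nth-upd l (suc i) e

upd-upd : ∀ (l : List A) i → upd i x (upd i y l) ≡ upd i x l
upd-upd []      _             = refl
upd-upd (_ ∷ _) zero          = refl
upd-upd (_ ∷ _) (suc zero)    = refl
upd-upd (z ∷ l) (suc (suc i)) = cong (z ∷_) (upd-upd l (suc i))

upd-nth-id : ∀ (l : List A) i → nth i l ≡ just x → upd i x l ≡ l
upd-nth-id (_ ∷ _) (suc zero)    refl = refl
upd-nth-id (z ∷ l) (suc (suc i)) e    = cong (z ∷_) (upd-nth-id l (suc i) e)

subL-nth : ∀ Γ i → nth i Γ ≡ just (α , S) → subL Γ i r T ≡ S ∣ r
subL-nth (_ ∷ _) (suc zero)    refl = refl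
subL-nth (_ ∷ Γ) (suc (suc i)) e    = subL-nth Γ (suc i) e

repL-nth : ∀ Γ i → nth i Γ ≡ just (α , S) → repL Γ i U r ≡ upd i (α , S [ U ]at r) Γ
repL-nth (_ ∷ _) (suc zero)    refl = refl
repL-nth (z ∷ Γ) (suc (suc i)) e    = cong (z ∷_) (repL-nth Γ (suc i) e)

∈Pos-replace-++ : k ∈Pos T → r ∈Pos U → (k ++ r) ∈Pos (T [ U ]at k)
∈Pos-replace-++ ε q = q
∈Pos-replace-++ {r = r} (_∷ₚ_ {Δ = Δ} {Γ} {i} {r = k} e p) q =
  subst ((i ∷ k ++ r) ∈Pos_) (sym (cong ⟨ Δ ⨾_⟩ (repL-nth Γ i e)))
    (nth-upd Γ i e ∷ₚ ∈Pos-replace-++ p q)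

∣-replace-++ : k ∈Pos T → (T [ U ]at k) ∣ (k ++ r) ≡ U ∣ r
∣-replace-++ ε = refl
∣-replace-++ {U = U} {r} (_∷ₚ_ {Δ = Δ} {Γ} {i} {α} {S} {k} e p) = begin
  ⟨ Δ ⨾ repL Γ i U k ⟩ ∣ (i ∷ k ++ r)
    ≡⟨ cong (λ Γ′ → ⟨ Δ ⨾ Γ′ ⟩ ∣ (i ∷ k ++ r)) (repL-nth Γ i e) ⟩
  ⟨ Δ ⨾ upd i (α , S [ U ]at k) Γ ⟩ ∣ (i ∷ k ++ r)
    ≡⟨ subL-nth (upd i _ Γ) i (nth-upd Γ i e) ⟩
  (S [ U ]at k) ∣ (k ++ r)
    ≡⟨ ∣-replace-++ p ⟩
  U ∣ r ∎

replace-replace-++ : k ∈Pos T →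
                     (T [ U ]at k) [ W ]at (k ++ r) ≡ T [ U [ W ]at r ]at k
replace-replace-++ ε = refl
replace-replace-++ {U = U} {W} {r} (_∷ₚ_ {Δ = Δ} {Γ} {i} {α} {S} {k} e p) = begin
  ⟨ Δ ⨾ repL Γ i U k ⟩ [ W ]at (i ∷ k ++ r)
    ≡⟨ cong (λ Γ′ → ⟨ Δ ⨾ Γ′ ⟩ [ W ]at (i ∷ k ++ r)) (repL-nth Γ i e) ⟩
  ⟨ Δ ⨾ upd i (α , S [ U ]at k) Γ ⟩ [ W ]at (i ∷ k ++ r)
    ≡⟨ cong ⟨ Δ ⨾_⟩ (repL-nth (upd i _ Γ) i (nth-upd Γ i e)) ⟩
  ⟨ Δ ⨾ upd i (α , (S [ U ]at k) [ W ]at (k ++ r)) (upd i (α , S [ U ]at k) Γ) ⟩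
    ≡⟨ cong ⟨ Δ ⨾_⟩ (upd-upd Γ i) ⟩
  ⟨ Δ ⨾ upd i (α , (S [ U ]at k) [ W ]at (k ++ r)) Γ ⟩
    ≡⟨ cong (λ S′ → ⟨ Δ ⨾ upd i (α , S′) Γ ⟩) (replace-replace-++ p) ⟩
  ⟨ Δ ⨾ upd i (α , S [ U [ W ]at r ]at k) Γ ⟩
    ≡⟨ cong ⟨ Δ ⨾_⟩ (repL-nth Γ i e) ⟨
  ⟨ Δ ⨾ Γ ⟩ [ U [ W ]at r ]at (i ∷ k) ∎

replace-∣-id : k ∈Pos T → T [ T ∣ k ]at k ≡ T
replace-∣-id ε = refl
replace-∣-id (_∷ₚ_ {Δ = Δ} {Γ} {i} {α} {S} {k} e p) = begin
  ⟨ Δ ⨾ Γ ⟩ [ subL Γ i k ⟨ Δ ⨾ Γ ⟩ ]at (i ∷ k)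
    ≡⟨ cong (λ X → ⟨ Δ ⨾ Γ ⟩ [ X ]at (i ∷ k)) (subL-nth Γ i e) ⟩
  ⟨ Δ ⨾ Γ ⟩ [ S ∣ k ]at (i ∷ k)
    ≡⟨ cong ⟨ Δ ⨾_⟩ (repL-nth Γ i e) ⟩
  ⟨ Δ ⨾ upd i (α , S [ S ∣ k ]at k) Γ ⟩
    ≡⟨ cong (λ S′ → ⟨ Δ ⨾ upd i (α , S′) Γ ⟩) (replace-∣-id p) ⟩
  ⟨ Δ ⨾ upd i (α , S) Γ ⟩
    ≡⟨ cong ⟨ Δ ⨾_⟩ (upd-nth-id Γ i e) ⟩
  ⟨ Δ ⨾ Γ ⟩ ∎

↪-replace : k ∈Pos T → U ↪ V → (T [ U ]at k) ↪ (T [ V ]at k)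
↪-replace {k} {T} {U} p (step r q s) =
  subst ((T [ U ]at k) ↪_) (replace-replace-++ p)
    (step (k ++ r) (∈Pos-replace-++ p q)
      (subst (λ X → RootStep X _) (sym (∣-replace-++ p)) s))

mainTheorem10 : (T : ModalTree) (k : Position) → k ∈Pos T →
                (S : ModalTree) → (T ∣ k) ↪* S → T ↪* (T [ S ]at k)
mainTheorem10 T k p S steps =
  subst (_↪* (T [ S ]at k)) (replace-∣-id p)
    (gmap (λ U → T [ U ]at k) (↪-replace p) steps)
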